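{- Let $p,s,t$ be parameters with $p\neq0$, and let $a_n=a_n(p,s,t)$ be defined by $a_0=1$, $a_1=p$ and, for $n\ge2$, $a_n=s\,a_{n-1}+t\sum_{k=0}^{n-3}a_{k+1}a_{n-k-2}$. Then the sequence $\left(\frac1p a_{n+1}\right)_{n\ge0}$ has generating function $\mathcal{J}(s,s,s,\dots;pt,pt,pt,\dots)$, and its Hankel transform is $\det\left(\frac1p a_{i+j+1}\right)_{0\le i,j\le n}=(pt)^{\binom{n+1}{2}}$ for all $n\ge0$.
   Context: $\mathcal{J}(\alpha_0,\alpha_1,\dots;\beta_1,\beta_2,\dots)$ denotes the power series given by the continued fraction $$\cfrac{1}{1-\alpha_0x-\cfrac{\beta_1x^2}{1-\alpha_1x-\cfrac{\beta_2x^2}{1-\alpha_2x-\cdots}}}.$$ -}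

module Defs where

open import Level using (Level; _⊔_)
open import Data.Nat as ℕ using (ℕ; zero; suc)
open import Data.Fin using (Fin; zero; suc; punchIn; toℕ)
open import Data.Product using (∃; _×_)
open import Relation.Nullary using (¬_)
open import Algebra.Bundles using (CommutativeRing)

module _ {c ℓ : Level} (R : CommutativeRing c ℓ) where
  open CommutativeRing R hiding (zero)

  IsField : Set (c ⊔ ℓ)
  IsField = (¬ (1# ≈ 0#)) × (∀ x → ¬ (x ≈ 0#) → ∃ λ y → x * y ≈ 1#)


  sumTo : ℕ → (ℕ → Carrier) → Carrier
  sumTo zero    f = 0#
  sumTo (suc n) f = sumTo n f + f n

  sumFin : ∀ n → (Fin n → Carrier) → Carrier
  sumFin zero    f = 0#
  sumFin (suc n) f = f zero + sumFin n (λ i → f (suc i))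

  pow : Carrier → ℕ → Carrier
  pow x zero    = 1#
  pow x (suc n) = x * pow x n

  sgn : ℕ → Carrier
  sgn zero    = 1#
  sgn (suc n) = - sgn n

  det : ∀ n → (Fin n → Fin n → Carrier) → Carrier
  det zero    M = 1#
  det (suc n) M =
    sumFin (suc n) (λ j → sgn (toℕ j) * (M zero j * det n (λ r c → M (suc r) (punchIn j c))))

  Series : Set c
  Series = ℕ → Carrier

  oneS : Series
  oneS zero    = 1#
  oneS (suc n) = 0#

  _⊕_ : Series → Series → Series
  (f ⊕ g) n = f n + g n

  _⊗_ : Series → Series → Series
  (f ⊗ g) n = sumTo (suc n) (λ k → f k * g (n ℕ.∸ k))

  powS : Series → ℕ → Series
  powS f zero    = oneS
  powS f (suc j) = f ⊗ powS f j

  xS : Series → Series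
  xS f zero    = 0#
  xS f (suc n) = f n

  constS : Carrier → Series
  constS a zero    = a
  constS a (suc n) = 0#

  -- 1/(1 - u) for u with zero constant term: Σ_{j≥0} u^j
  -- (coefficient n only involves j ≤ n).
  geom : Series → Series
  geom u n = sumTo (suc n) (λ j → powS u j n)

  -- Depth-k truncation of the J-fraction J(α₀,α₁,…; β₁,β₂,…):
  --   J₀ = 1,  J_{k+1}(α;β) = 1 / (1 - α₀ x - β₁ x² J_k(α∘suc; β∘suc)).
  -- Here β is indexed so that β 0 = β₁, β 1 = β₂, ….
  Jtrunc : ℕ → (ℕ → Carrier) → (ℕ → Carrier) → Series
  Jtrunc zero    α β = oneS
  Jtrunc (suc k) α β =
    geom (xS (constS (α 0)) ⊕ xS (xS (constS (β 0) ⊗ Jtrunc k (λ i → α (suc i)) (λ i → β (suc i)))))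

  -- Coefficients of the (infinite) J-fraction: coefficient n is already
  -- determined by the depth-(n+1) truncation (it agrees with the limit up to x^(2n+1)).
  J : (ℕ → Carrier) → (ℕ → Carrier) → Series
  J α β n = Jtrunc (suc n) α β n

module Submission where

-- Put bₙ = p⁻¹ aₙ₊₁ and β = p t: then b₀ = 1 and bₙ₊₁ = s bₙ + β (b ⋆ b)ₙ, where
-- (f ⋆ g)ₙ = Σ_{j<n} f_j g_{n-1-j} is the coefficient of xⁿ in x f(x) g(x).  Both
-- claims are proved for any such sequence over an arbitrary commutative ring.
--
-- J-fraction: the depth-(k+1) truncation G = 1/(1 - s x - β x² T) of J(s,s,…;β,β,…),
-- T being the depth-k one, satisfies G₀ = 1 and Gₙ₊₁ = s Gₙ + β (T ⋆ G)ₙ; as this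
-- recurrence determines its solution, the depth-k truncation agrees with b to degree k.
--
-- Hankel determinant: the Stieltjes table μₙₖ = [xⁿ] xᵏ B(x)ᵏ⁺¹ is lower unitriangular
-- and its rows evolve by the tridiagonal operator (Tu)ₖ = u_{k-1} + s uₖ + β u_{k+1},
-- self-adjoint for the weights βᵏ.  Hence b_{i+j} = Σₖ μᵢₖ βᵏ μⱼₖ: the Hankel matrix
-- is L·U, L lower unitriangular, U upper triangular with diagonal (βᵏ)ₖ.  Laplace
-- expansion is multilinear and alternating in the rows, so det (L·U) = det U = β^(n C 2).

open import Defs
open import Level using (Level)
open import Data.Nat as ℕ using (ℕ; zero; suc; _∸_)
open import Data.Nat.Combinatorics using (_C_; nC1≡n; nCk+nC[k+1]≡[n+1]C[k+1])
open import Data.Fin as Fin using (Fin; toℕ; punchIn)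
open import Data.Fin.Properties using (toℕ<n; suc-injective)
import Data.Nat.Properties as ℕₚ
open import Data.Nat.Induction using (<-rec)
open import Data.Product using (_×_; _,_)
open import Data.Empty using (⊥-elim)
open import Relation.Nullary using (¬_)
open import Relation.Binary.PropositionalEquality as ≡ using (_≡_; _≢_)
open import Algebra.Bundles using (CommutativeRing)
open import Function using (_∘_)

∸-peel : ∀ {n i} → i ℕ.< n → n ∸ i ≡ suc (n ∸ suc i)
∸-peel {suc n} {zero}  _         = ≡.refl
∸-peel {suc n} {suc i} (ℕ.s≤s h) = ∸-peel h

pascal₂ : ∀ n → suc n C 2 ≡ n C 2 ℕ.+ n
pascal₂ n = ≡.trans (≡.sym (nCk+nC[k+1]≡[n+1]C[k+1] n 1))
                    (≡.trans (≡.cong (ℕ._+ n C 2) (nC1≡n n)) (ℕₚ.+-comm n (n C 2)))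

module _ {c ℓ : Level} (R : CommutativeRing c ℓ) where
  open CommutativeRing R hiding (zero)
  open import Relation.Binary.Reasoning.Setoid setoid
  open import Algebra.Properties.Ring ring
    using (-‿distribˡ-*; -‿distribʳ-*; -‿+-comm; -‿involutive; -0#≈0#; +-inverseʳ-unique)
  open import Algebra.Solver.Ring.NaturalCoefficients.Default commutativeSemiring

  *-absorbˡ : ∀ {x} y → x ≈ 0# → x * y ≈ 0#
  *-absorbˡ y h = trans (*-congʳ h) (zeroˡ y)

  *-absorbʳ : ∀ x {y} → y ≈ 0# → x * y ≈ 0#
  *-absorbʳ x h = trans (*-congˡ h) (zeroʳ x)

  Σ : ℕ → (ℕ → Carrier) → Carrier
  Σ = sumTo R

  Σ-cong : ∀ n {f g : ℕ → Carrier} → (∀ k → k ℕ.< n → f k ≈ g k) → Σ n f ≈ Σ n g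
  Σ-cong zero    eq = refl
  Σ-cong (suc n) eq = +-cong (Σ-cong n (λ k h → eq k (ℕₚ.m<n⇒m<1+n h))) (eq n (ℕₚ.n<1+n n))

  Σ-zero : ∀ n {f : ℕ → Carrier} → (∀ k → k ℕ.< n → f k ≈ 0#) → Σ n f ≈ 0#
  Σ-zero n h = trans (Σ-cong n h) (Σ-zero′ n)
    where
    Σ-zero′ : ∀ n → Σ n (λ _ → 0#) ≈ 0#
    Σ-zero′ zero    = refl
    Σ-zero′ (suc n) = trans (+-identityʳ _) (Σ-zero′ n)

  Σ-+ : ∀ n f g → Σ n (λ k → f k + g k) ≈ Σ n f + Σ n g
  Σ-+ zero    f g = sym (+-identityˡ 0#)
  Σ-+ (suc n) f g = trans (+-congʳ (Σ-+ n f g))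
    (solve 4 (λ a b c d → (a :+ b) :+ (c :+ d) := (a :+ c) :+ (b :+ d)) refl (Σ n f) (Σ n g) (f n) (g n))

  Σ-*ˡ : ∀ n a f → a * Σ n f ≈ Σ n (λ k → a * f k)
  Σ-*ˡ zero    a f = zeroʳ a
  Σ-*ˡ (suc n) a f = trans (distribˡ a (Σ n f) (f n)) (+-congʳ (Σ-*ˡ n a f))

  Σ-*ʳ : ∀ n a f → Σ n f * a ≈ Σ n (λ k → f k * a)
  Σ-*ʳ n a f = trans (*-comm _ a) (trans (Σ-*ˡ n a f) (Σ-cong n (λ k _ → *-comm a (f k))))

  Σ-head : ∀ n f → Σ (suc n) f ≈ f 0 + Σ n (λ k → f (suc k))
  Σ-head zero    f = trans (+-identityˡ (f 0)) (sym (+-identityʳ (f 0)))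
  Σ-head (suc n) f = trans (+-congʳ (Σ-head n f)) (+-assoc _ _ _)

  Σ-swap : ∀ A B (F : ℕ → ℕ → Carrier) →
           Σ A (λ j → Σ B (λ k → F j k)) ≈ Σ B (λ k → Σ A (λ j → F j k))
  Σ-swap zero    B F = sym (Σ-zero B (λ _ _ → refl))
  Σ-swap (suc A) B F = trans (+-congʳ (Σ-swap A B F)) (sym (Σ-+ B (λ k → Σ A (λ j → F j k)) (F A)))

  Σ-length : ∀ {m n} f → m ≡ n → Σ m f ≈ Σ n f
  Σ-length f ≡.refl = refl

  Σ-pad : ∀ a d f → (∀ j → a ℕ.≤ j → f j ≈ 0#) → Σ (a ℕ.+ d) f ≈ Σ a f
  Σ-pad a zero    f h = Σ-length f (ℕₚ.+-identityʳ a)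
  Σ-pad a (suc d) f h = begin
    Σ (a ℕ.+ suc d) f                ≈⟨ Σ-length f (ℕₚ.+-suc a d) ⟩
    Σ (a ℕ.+ d) f + f (a ℕ.+ d)      ≈⟨ +-cong (Σ-pad a d f h) (h (a ℕ.+ d) (ℕₚ.m≤m+n a d)) ⟩
    Σ a f + 0#                       ≈⟨ +-identityʳ _ ⟩
    Σ a f                            ∎

  Σ-triangle : ∀ n (F : ℕ → ℕ → Carrier) →
    Σ n (λ j → Σ j (λ i → F i j)) ≈ Σ n (λ i → Σ (n ∸ suc i) (λ l → F i (suc (i ℕ.+ l))))
  Σ-triangle zero    F = refl
  Σ-triangle (suc n) F = begin
    Σ n (λ j → Σ j (λ i → F i j)) + Σ n (λ i → F i n)
      ≈⟨ +-congʳ (Σ-triangle n F) ⟩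
    Σ n (λ i → Σ (n ∸ suc i) (G i)) + Σ n (λ i → F i n)
      ≈⟨ Σ-+ n _ _ ⟨
    Σ n (λ i → Σ (n ∸ suc i) (G i) + F i n)
      ≈⟨ Σ-cong n extend ⟩
    Σ n (λ i → Σ (n ∸ i) (G i))
      ≈⟨ +-identityʳ _ ⟨
    Σ n (λ i → Σ (n ∸ i) (G i)) + 0#
      ≈⟨ +-congˡ (Σ-length (G n) (≡.sym (ℕₚ.n∸n≡0 n))) ⟩
    Σ (suc n) (λ i → Σ (suc n ∸ suc i) (G i)) ∎
    where
    G : ℕ → ℕ → Carrier
    G i l = F i (suc (i ℕ.+ l))
    -- the new summand F i n is the last term of the row of i
    extend : ∀ i → i ℕ.< n → Σ (n ∸ suc i) (G i) + F i n ≈ Σ (n ∸ i) (G i)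
    extend i h = trans (+-congˡ (reflexive (≡.cong (F i) (≡.sym (ℕₚ.m+[n∸m]≡n h)))))
                       (Σ-length (G i) (≡.sym (∸-peel h)))

  -- The shifted Cauchy product: (f ⋆ g) n is the coefficient of xⁿ in x·f(x)·g(x).
  _⋆_ : Series R → Series R → Series R
  (f ⋆ g) n = Σ n (λ j → f j * g (n ∸ suc j))

  ⋆-assoc : ∀ f g h n → ((f ⋆ g) ⋆ h) n ≈ (f ⋆ (g ⋆ h)) n
  ⋆-assoc f g h n = begin
    Σ n (λ j → Σ j (λ i → f i * g (j ∸ suc i)) * h (n ∸ suc j))
      ≈⟨ Σ-cong n (λ j _ → Σ-*ʳ j _ _) ⟩
    Σ n (λ j → Σ j (λ i → F i j))
      ≈⟨ Σ-triangle n F ⟩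
    Σ n (λ i → Σ (n ∸ suc i) (λ l → F i (suc (i ℕ.+ l))))
      ≈⟨ Σ-cong n (λ i _ → Σ-cong (n ∸ suc i) (λ l _ → reassociate i l)) ⟩
    Σ n (λ i → Σ (n ∸ suc i) (λ l → f i * (g l * h (n ∸ suc i ∸ suc l))))
      ≈⟨ Σ-cong n (λ i _ → Σ-*ˡ (n ∸ suc i) (f i) _) ⟨
    Σ n (λ i → f i * Σ (n ∸ suc i) (λ l → g l * h (n ∸ suc i ∸ suc l))) ∎
    where
    F : ℕ → ℕ → Carrier
    F i j = (f i * g (j ∸ suc i)) * h (n ∸ suc j)
    reassociate : ∀ i l → F i (suc (i ℕ.+ l)) ≈ f i * (g l * h (n ∸ suc i ∸ suc l))
    reassociate i l
      rewrite ℕₚ.m+n∸m≡n i l | ℕₚ.∸-+-assoc n (suc i) (suc l) | ℕₚ.+-suc i l = *-assoc _ _ _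

  pow-+ : ∀ x m n → pow R x (m ℕ.+ n) ≈ pow R x m * pow R x n
  pow-+ x zero    n = sym (*-identityˡ _)
  pow-+ x (suc m) n = trans (*-congˡ (pow-+ x m n)) (sym (*-assoc _ _ _))

  ∏ : ℕ → (ℕ → Carrier) → Carrier
  ∏ zero    d = 1#
  ∏ (suc n) d = ∏ n d * d n

  ∏-head : ∀ n d → ∏ (suc n) d ≈ d 0 * ∏ n (λ k → d (suc k))
  ∏-head zero    d = trans (*-identityˡ (d 0)) (sym (*-identityʳ (d 0)))
  ∏-head (suc n) d = trans (*-congʳ (∏-head n d)) (*-assoc _ _ _)

  ∏-powers : ∀ β n → ∏ n (pow R β) ≈ pow R β (n C 2)
  ∏-powers β zero    = refl
  ∏-powers β (suc n) = begin
    ∏ n (pow R β) * pow R β n       ≈⟨ *-congʳ (∏-powers β n) ⟩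
    pow R β (n C 2) * pow R β n     ≈⟨ pow-+ β (n C 2) n ⟨
    pow R β (n C 2 ℕ.+ n)           ≡⟨ ≡.cong (pow R β) (≡.sym (pascal₂ n)) ⟩
    pow R β (suc n C 2)             ∎

  ΣF : ∀ n → (Fin n → Carrier) → Carrier
  ΣF = sumFin R

  ΣF-cong : ∀ n {f g : Fin n → Carrier} → (∀ k → f k ≈ g k) → ΣF n f ≈ ΣF n g
  ΣF-cong zero    eq = refl
  ΣF-cong (suc n) eq = +-cong (eq Fin.zero) (ΣF-cong n (λ k → eq (Fin.suc k)))

  ΣF-zero : ∀ n {f : Fin n → Carrier} → (∀ k → f k ≈ 0#) → ΣF n f ≈ 0#
  ΣF-zero zero    h = refl
  ΣF-zero (suc n) h = trans (+-cong (h Fin.zero) (ΣF-zero n (λ k → h (Fin.suc k)))) (+-identityˡ 0#)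

  ΣF-+ : ∀ n (f g : Fin n → Carrier) → ΣF n (λ k → f k + g k) ≈ ΣF n f + ΣF n g
  ΣF-+ zero    f g = sym (+-identityˡ 0#)
  ΣF-+ (suc n) f g = trans (+-congˡ (ΣF-+ n _ _))
    (solve 4 (λ a b c d → (a :+ b) :+ (c :+ d) := (a :+ c) :+ (b :+ d)) refl
       (f Fin.zero) (g Fin.zero) (ΣF n (λ k → f (Fin.suc k))) (ΣF n (λ k → g (Fin.suc k))))

  ΣF-*ˡ : ∀ n a (f : Fin n → Carrier) → a * ΣF n f ≈ ΣF n (λ k → a * f k)
  ΣF-*ˡ zero    a f = zeroʳ a
  ΣF-*ˡ (suc n) a f = trans (distribˡ a _ _) (+-congˡ (ΣF-*ˡ n a _))

  ΣF-neg : ∀ n (f : Fin n → Carrier) → ΣF n (λ k → - f k) ≈ - ΣF n f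
  ΣF-neg zero    f = sym -0#≈0#
  ΣF-neg (suc n) f = trans (+-congˡ (ΣF-neg n _)) (-‿+-comm _ _)

  ΣF-toℕ : ∀ n (g : ℕ → Carrier) → ΣF n (λ i → g (toℕ i)) ≈ Σ n g
  ΣF-toℕ zero    g = refl
  ΣF-toℕ (suc n) g = trans (+-congˡ (ΣF-toℕ n (λ k → g (suc k)))) (sym (Σ-head n g))

  Mat : ℕ → Set c
  Mat n = Fin n → Fin n → Carrier

  sg : ∀ {n} → Fin n → Carrier
  sg j = sgn R (toℕ j)

  minor : ∀ {n} → Mat (suc n) → Fin (suc n) → Mat n
  minor M j r c = M (Fin.suc r) (punchIn j c)

  det-expansion-cong : ∀ n (M N : Mat (suc n)) → (∀ j → M Fin.zero j ≈ N Fin.zero j) →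
                       (∀ j → det R n (minor M j) ≈ det R n (minor N j)) →
                       det R (suc n) M ≈ det R (suc n) N
  det-expansion-cong n M N row minors =
    ΣF-cong (suc n) (λ j → *-congˡ {x = sg j} (*-cong (row j) (minors j)))

  det-cong : ∀ n {M N : Mat n} → (∀ i j → M i j ≈ N i j) → det R n M ≈ det R n N
  det-cong zero    eq = refl
  det-cong (suc n) {M} {N} eq = det-expansion-cong n M N (eq Fin.zero)
                          (λ j → det-cong n (λ r c → eq (Fin.suc r) (punchIn j c)))

  det-linear : ∀ n (r : Fin n) (M N K : Mat n) → (∀ c → M r c ≈ N r c + K r c) →
               (∀ i → i ≢ r → ∀ c → M i c ≈ N i c) → (∀ i → i ≢ r → ∀ c → M i c ≈ K i c) →
               det R n M ≈ det R n N + det R n K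
  det-linear (suc n) r M N K hr hN hK =
    trans (ΣF-cong (suc n) (termwise r hr hN hK))
          (ΣF-+ (suc n) (λ j → sg j * (N Fin.zero j * det R n (minor N j)))
                        (λ j → sg j * (K Fin.zero j * det R n (minor K j))))
    where
    sucne : ∀ {i r : Fin n} → i ≢ r → Fin.suc i ≢ Fin.suc r
    sucne ne eq = ne (suc-injective eq)
    termwise : ∀ r → (∀ c → M r c ≈ N r c + K r c) →
               (∀ i → i ≢ r → ∀ c → M i c ≈ N i c) → (∀ i → i ≢ r → ∀ c → M i c ≈ K i c) →
               ∀ j → sg j * (M Fin.zero j * det R n (minor M j))
                   ≈ sg j * (N Fin.zero j * det R n (minor N j)) + sg j * (K Fin.zero j * det R n (minor K j))
    -- row 0 enters through the expansion coefficients, a later row through the minors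
    termwise Fin.zero hr hN hK j =
      trans (*-congˡ (*-cong (hr j) (det-cong n (λ r c → hN (Fin.suc r) (λ ()) (punchIn j c)))))
      (trans (solve 4 (λ g x y d → g :* ((x :+ y) :* d) := g :* (x :* d) :+ g :* (y :* d)) refl
                (sg j) (N Fin.zero j) (K Fin.zero j) (det R n (minor N j)))
             (+-congˡ (*-congˡ (*-congˡ (det-cong n (λ r c →
                trans (sym (hN (Fin.suc r) (λ ()) (punchIn j c))) (hK (Fin.suc r) (λ ()) (punchIn j c))))))))
    termwise (Fin.suc r) hr hN hK j =
      trans (*-congˡ (*-congˡ (det-linear n r (minor M j) (minor N j) (minor K j) (λ c → hr (punchIn j c))
               (λ i ne c → hN (Fin.suc i) (sucne ne) (punchIn j c))
               (λ i ne c → hK (Fin.suc i) (sucne ne) (punchIn j c)))))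
      (trans (solve 4 (λ g x y z → g :* (x :* (y :+ z)) := g :* (x :* y) :+ g :* (x :* z)) refl
                (sg j) (M Fin.zero j) (det R n (minor N j)) (det R n (minor K j)))
             (+-cong (*-congˡ (*-congʳ (hN Fin.zero (λ ()) j))) (*-congˡ (*-congʳ (hK Fin.zero (λ ()) j)))))

  -- The Laplace expansion of a determinant along its first two rows is a signed sum
  -- over ordered pairs (a, b) of distinct columns; the remaining columns are given by
  -- an embedding e.
  PairTerm : ℕ → Set c
  PairTerm n = Fin (suc (suc n)) → Fin (suc (suc n)) → (Fin n → Fin (suc (suc n))) → Carrier

  pairSum : ∀ n → PairTerm n → Carrier
  pairSum n Φ = ΣF (suc (suc n)) (λ j → sg j *
                  ΣF (suc n) (λ k → sg k * Φ j (punchIn j k) (λ c → punchIn j (punchIn k c))))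

  Symmetric : ∀ {n} → PairTerm n → Set ℓ
  Symmetric Φ = ∀ a b e → Φ a b e ≈ Φ b a e

  Extensional : ∀ {n} → PairTerm n → Set ℓ
  Extensional Φ = ∀ a b e e′ → (∀ c → e c ≡ e′ c) → Φ a b e ≈ Φ a b e′

  besides₀ : ∀ {n} → Fin (suc n) → Fin n → Fin (suc (suc n))
  besides₀ k c = Fin.suc (punchIn k c)

  boundaryPairs : ∀ n → PairTerm n → Carrier
  boundaryPairs n Φ = ΣF (suc n) (λ k → sg k * Φ Fin.zero (Fin.suc k) (besides₀ k)
                                        + - (sg k * Φ (Fin.suc k) Fin.zero (besides₀ k)))

  innerRow : ∀ n → PairTerm n → Fin (suc n) → Carrier
  innerRow n Φ j = ΣF n (λ k → - sg k *
    Φ (Fin.suc j) (Fin.suc (punchIn j k)) (λ c → punchIn (Fin.suc j) (punchIn (Fin.suc k) c)))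

  innerPairs : ∀ n → PairTerm n → Carrier
  innerPairs n Φ = ΣF (suc n) (λ j → - sg j * innerRow n Φ j)

  pairSum-split : ∀ n (Φ : PairTerm n) → pairSum n Φ ≈ boundaryPairs n Φ + innerPairs n Φ
  pairSum-split n Φ = begin
    1# * ΣF (suc n) first + ΣF (suc n) (λ j → - sg j * (1# * Φ (Fin.suc j) Fin.zero (besides₀ j) + innerRow n Φ j))
      ≈⟨ +-cong (*-identityˡ _) (trans (ΣF-cong (suc n) distribute)
                                       (ΣF-+ (suc n) second (λ j → - sg j * innerRow n Φ j))) ⟩
    ΣF (suc n) first + (ΣF (suc n) second + innerPairs n Φ)
      ≈⟨ +-assoc _ _ _ ⟨
    (ΣF (suc n) first + ΣF (suc n) second) + innerPairs n Φ
      ≈⟨ +-congʳ (ΣF-+ (suc n) first second) ⟨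
    boundaryPairs n Φ + innerPairs n Φ ∎
    where
    first second : Fin (suc n) → Carrier
    first  k = sg k * Φ Fin.zero (Fin.suc k) (besides₀ k)
    second k = - (sg k * Φ (Fin.suc k) Fin.zero (besides₀ k))
    distribute : ∀ j → - sg j * (1# * Φ (Fin.suc j) Fin.zero (besides₀ j) + innerRow n Φ j)
                       ≈ second j + - sg j * innerRow n Φ j
    distribute j = trans (distribˡ (- sg j) _ _)
                         (+-congʳ (trans (*-congˡ (*-identityˡ _)) (sym (-‿distribˡ-* (sg j) _))))

  -- For a symmetric pair term the alternating pair sum vanishes: the pairs (a, b) and
  -- (b, a) carry opposite signs.  By induction on the number of columns.
  pairSum-vanishes : ∀ n (Φ : PairTerm n) → Symmetric Φ → Extensional Φ → pairSum n Φ ≈ 0#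
  innerPairs-vanish : ∀ n (Φ : PairTerm n) → Symmetric Φ → Extensional Φ → innerPairs n Φ ≈ 0#

  pairSum-vanishes n Φ sym-Φ ext-Φ = begin
    pairSum n Φ                         ≈⟨ pairSum-split n Φ ⟩
    boundaryPairs n Φ + innerPairs n Φ  ≈⟨ +-cong (ΣF-zero (suc n) cancel) (innerPairs-vanish n Φ sym-Φ ext-Φ) ⟩
    0# + 0#                             ≈⟨ +-identityˡ 0# ⟩
    0#                                  ∎
    where
    cancel : ∀ k → sg k * Φ Fin.zero (Fin.suc k) (besides₀ k)
                   + - (sg k * Φ (Fin.suc k) Fin.zero (besides₀ k)) ≈ 0#
    cancel k = trans (+-congˡ (-‿cong (*-congˡ (sym-Φ (Fin.suc k) Fin.zero (besides₀ k))))) (-‿inverseʳ _)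

  innerPairs-vanish zero    Φ sym-Φ ext-Φ = ΣF-zero 1 (λ k → zeroʳ (- sg k))
  innerPairs-vanish (suc m) Φ sym-Φ ext-Φ =
    trans (ΣF-cong (suc (suc m)) signs)
          (pairSum-vanishes m Φ′ (λ a b e → sym-Φ _ _ _) (λ a b e e′ h → ext-Φ _ _ _ _ (lift-cong h)))
    where
    Φ′ : PairTerm m
    Φ′ a b e = Φ (Fin.suc a) (Fin.suc b) (Fin.lift 1 e)
    lift-cong : ∀ {e e′ : Fin m → Fin (suc (suc m))} → (∀ c → e c ≡ e′ c) →
                ∀ c → Fin.lift 1 e c ≡ Fin.lift 1 e′ c
    lift-cong h Fin.zero    = ≡.refl
    lift-cong h (Fin.suc c) = ≡.cong Fin.suc (h c)
    shifted : Fin (suc (suc m)) → Fin (suc m) → Carrier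
    shifted j k = sg k * Φ′ j (punchIn j k) (λ c → punchIn j (punchIn k c))
    signs : ∀ j → - sg j * innerRow (suc m) Φ j ≈ sg j * ΣF (suc m) (shifted j)
    signs j = begin
      - sg j * innerRow (suc m) Φ j         ≈⟨ *-congˡ (trans (ΣF-cong (suc m) inner) (ΣF-neg (suc m) (shifted j))) ⟩
      - sg j * - ΣF (suc m) (shifted j)     ≈⟨ -‿distribˡ-* (sg j) _ ⟨
      - (sg j * - ΣF (suc m) (shifted j))   ≈⟨ -‿cong (-‿distribʳ-* (sg j) _) ⟨
      - - (sg j * ΣF (suc m) (shifted j))   ≈⟨ -‿involutive _ ⟩
      sg j * ΣF (suc m) (shifted j)         ∎
      where
      inner : ∀ k → - sg k * Φ (Fin.suc j) (Fin.suc (punchIn j k)) (λ c → punchIn (Fin.suc j) (punchIn (Fin.suc k) c))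
                    ≈ - shifted j k
      inner k = trans (sym (-‿distribˡ-* (sg k) _)) (-‿cong (*-congˡ (ext-Φ _ _ _ _
                  (λ { Fin.zero → ≡.refl ; (Fin.suc c) → ≡.refl }))))

  det-proportionalRows : ∀ n (M : Mat (suc (suc n))) x → (∀ c → M (Fin.suc Fin.zero) c ≈ x * M Fin.zero c) →
                         det R (suc (suc n)) M ≈ 0#
  det-proportionalRows n M x h = trans (ΣF-cong (suc (suc n)) expand) (pairSum-vanishes n Φ sym-Φ ext-Φ)
    where
    Φ : PairTerm n
    Φ a b e = (x * (M Fin.zero a * M Fin.zero b)) * det R n (λ r c → M (Fin.suc (Fin.suc r)) (e c))
    sym-Φ : Symmetric Φ
    sym-Φ a b e = *-congʳ (*-congˡ (*-comm _ _))
    ext-Φ : Extensional Φ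
    ext-Φ a b e e′ h = *-congˡ (det-cong n (λ r c → reflexive (≡.cong (M (Fin.suc (Fin.suc r))) (h c))))
    expand : ∀ j → sg j * (M Fin.zero j * det R (suc n) (minor M j))
                   ≈ sg j * ΣF (suc n) (λ k → sg k * Φ j (punchIn j k) (λ c → punchIn j (punchIn k c)))
    expand j = *-congˡ {x = sg j} (trans (ΣF-*ˡ (suc n) (M Fin.zero j)
      (λ k → sg k * (M (Fin.suc Fin.zero) (punchIn j k) * det R n (minor (minor M j) k)))) (ΣF-cong (suc n) term))
      where
      term : ∀ k → M Fin.zero j * (sg k * (M (Fin.suc Fin.zero) (punchIn j k) * det R n (minor (minor M j) k)))
                   ≈ sg k * Φ j (punchIn j k) (λ c → punchIn j (punchIn k c))
      term k = trans (*-congˡ {x = M Fin.zero j} (*-congˡ {x = sg k} (*-congʳ (h (punchIn j k)))))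
        (solve 5 (λ m g x' m' d → m :* (g :* ((x' :* m') :* d)) := g :* ((x' :* (m :* m')) :* d)) refl
           (M Fin.zero j) (sg k) x (M Fin.zero (punchIn j k)) (det R n (minor (minor M j) k)))

  Row : ℕ → Set c
  Row n = Fin n → Carrier

  withRows01 : ∀ {n} → Mat (suc (suc n)) → Row (suc (suc n)) → Row (suc (suc n)) → Mat (suc (suc n))
  withRows01 M u v Fin.zero                = u
  withRows01 M u v (Fin.suc Fin.zero)      = v
  withRows01 M u v (Fin.suc (Fin.suc i))   = M (Fin.suc (Fin.suc i))

  withRows01-self : ∀ {n} (M : Mat (suc (suc n))) i c →
                    withRows01 M (M Fin.zero) (M (Fin.suc Fin.zero)) i c ≈ M i c
  withRows01-self M Fin.zero                c = refl
  withRows01-self M (Fin.suc Fin.zero)      c = refl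
  withRows01-self M (Fin.suc (Fin.suc i))   c = refl

  det-linear₀ : ∀ n (M : Mat (suc (suc n))) u u′ v →
    det R _ (withRows01 M (λ c → u c + u′ c) v) ≈ det R _ (withRows01 M u v) + det R _ (withRows01 M u′ v)
  det-linear₀ n M u u′ v = det-linear _ Fin.zero
    (withRows01 M (λ c → u c + u′ c) v) (withRows01 M u v) (withRows01 M u′ v) (λ c → refl) other other
    where
    other : ∀ {a b} i → i ≢ Fin.zero → ∀ c → withRows01 M a v i c ≈ withRows01 M b v i c
    other Fin.zero              ne c = ⊥-elim (ne ≡.refl)
    other (Fin.suc Fin.zero)    ne c = refl
    other (Fin.suc (Fin.suc i)) ne c = refl

  det-linear₁ : ∀ n (M : Mat (suc (suc n))) u v v′ →
    det R _ (withRows01 M u (λ c → v c + v′ c)) ≈ det R _ (withRows01 M u v) + det R _ (withRows01 M u v′)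
  det-linear₁ n M u v v′ = det-linear _ (Fin.suc Fin.zero)
    (withRows01 M u (λ c → v c + v′ c)) (withRows01 M u v) (withRows01 M u v′) (λ c → refl) other other
    where
    other : ∀ {a b} i → i ≢ Fin.suc Fin.zero → ∀ c → withRows01 M u a i c ≈ withRows01 M u b i c
    other Fin.zero              ne c = refl
    other (Fin.suc Fin.zero)    ne c = ⊥-elim (ne ≡.refl)
    other (Fin.suc (Fin.suc i)) ne c = refl

  det-swap01 : ∀ n (M : Mat (suc (suc n))) u v →
               det R _ (withRows01 M v u) ≈ - det R _ (withRows01 M u v)
  det-swap01 n M u v = +-inverseʳ-unique (D u v) (D v u) (begin
      D u v + D v u                     ≈⟨ +-cong (+-identityˡ _) (+-identityʳ _) ⟨
      (0# + D u v) + (D v u + 0#)       ≈⟨ +-cong (+-congʳ (equal u)) (+-congˡ (equal v)) ⟨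
      (D u u + D u v) + (D v u + D v v) ≈⟨ +-cong (det-linear₁ n M u u v) (det-linear₁ n M v u v) ⟨
      D u w + D v w                     ≈⟨ det-linear₀ n M u v w ⟨
      D w w                             ≈⟨ equal w ⟩
      0#                                ∎)
    where
    D : Row (suc (suc n)) → Row (suc (suc n)) → Carrier
    D a b = det R _ (withRows01 M a b)
    w : Row (suc (suc n))
    w c = u c + v c
    equal : ∀ a → D a a ≈ 0#
    equal a = det-proportionalRows n (withRows01 M a a) 1# (λ c → sym (*-identityˡ (a c)))

  det-addToRow1 : ∀ n (M : Mat (suc (suc n))) u v x →
                  det R _ (withRows01 M u (λ c → v c + x * u c)) ≈ det R _ (withRows01 M u v)
  det-addToRow1 n M u v x = begin
    det R _ (withRows01 M u (λ c → v c + x * u c))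
      ≈⟨ det-linear₁ n M u v (λ c → x * u c) ⟩
    det R _ (withRows01 M u v) + det R _ (withRows01 M u (λ c → x * u c))
      ≈⟨ +-congˡ (det-proportionalRows n (withRows01 M u (λ c → x * u c)) x (λ c → refl)) ⟩
    det R _ (withRows01 M u v) + 0#
      ≈⟨ +-identityʳ _ ⟩
    det R _ (withRows01 M u v) ∎

  -- The second row is cleared by det-addToRow1; after exchanging the first
  -- two rows the remaining rows are handled in the minors, by induction.
  det-addFirstRowMultiples : ∀ n (M N : Mat (suc n)) (u : Fin n → Carrier) →
    (∀ c → N Fin.zero c ≈ M Fin.zero c) →
    (∀ i c → N (Fin.suc i) c ≈ M (Fin.suc i) c + u i * M Fin.zero c) →
    det R (suc n) N ≈ det R (suc n) M
  det-addFirstRowMultiples zero M N u h₀ hₛ = det-cong 1 {N} {M} (λ { Fin.zero c → h₀ c ; (Fin.suc ()) c })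
  det-addFirstRowMultiples (suc n) M N u h₀ hₛ = begin
    det R _ N
      ≈⟨ det-cong _ row1 ⟩
    det R _ (withRows01 N (N Fin.zero) (λ c → M₁ c + u Fin.zero * N Fin.zero c))
      ≈⟨ det-addToRow1 n N (N Fin.zero) M₁ (u Fin.zero) ⟩
    det R _ (withRows01 N (N Fin.zero) M₁)
      ≈⟨ det-swap01 n N M₁ (N Fin.zero) ⟩
    - det R _ swappedN
      ≈⟨ -‿cong (det-expansion-cong (suc n) swappedN swappedM (λ j → refl) minors) ⟩
    - det R _ swappedM
      ≈⟨ -‿cong (det-swap01 n M (M Fin.zero) M₁) ⟩
    - - det R _ (withRows01 M (M Fin.zero) M₁)
      ≈⟨ -‿involutive _ ⟩
    det R _ (withRows01 M (M Fin.zero) M₁)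
      ≈⟨ det-cong _ (withRows01-self M) ⟩
    det R _ M ∎
    where
    M₁ : Row (suc (suc n))
    M₁ = M (Fin.suc Fin.zero)
    swappedN swappedM : Mat (suc (suc n))
    swappedN = withRows01 N M₁ (N Fin.zero)
    swappedM = withRows01 M M₁ (M Fin.zero)
    row1 : ∀ i c → N i c ≈ withRows01 N (N Fin.zero) (λ c → M₁ c + u Fin.zero * N Fin.zero c) i c
    row1 Fin.zero              c = refl
    row1 (Fin.suc Fin.zero)    c = trans (hₛ Fin.zero c) (+-congˡ (*-congˡ (sym (h₀ c))))
    row1 (Fin.suc (Fin.suc i)) c = refl
    -- below their common first row, swappedN is swappedM plus multiples of M's first row
    minors : ∀ j → det R (suc n) (minor swappedN j) ≈ det R (suc n) (minor swappedM j)
    minors j = det-addFirstRowMultiples n (minor swappedM j) (minor swappedN j) (λ i → u (Fin.suc i))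
                 (λ c → h₀ (punchIn j c)) (λ i c → hₛ (Fin.suc i) (punchIn j c))

  det-unitriangular : ∀ n (L V : Mat n) → (∀ i → L i i ≈ 1#) →
                      (∀ i k → toℕ i ℕ.< toℕ k → L i k ≈ 0#) →
                      det R n (λ i j → ΣF n (λ k → L i k * V k j)) ≈ det R n V
  det-unitriangular zero    L V diag upper = refl
  det-unitriangular (suc n) L V diag upper =
    trans (det-addFirstRowMultiples n W LV (λ i → L (Fin.suc i) Fin.zero) row0 (λ i c → +-comm _ _))
          (det-expansion-cong n W V (λ j → refl) minors)
    where
    LV W : Mat (suc n)
    LV i j = ΣF (suc n) (λ k → L i k * V k j)
    W Fin.zero    = V Fin.zero
    W (Fin.suc i) c = ΣF n (λ k → L (Fin.suc i) (Fin.suc k) * V (Fin.suc k) c)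
    row0 : ∀ c → LV Fin.zero c ≈ W Fin.zero c
    row0 c = trans (+-cong (trans (*-congʳ (diag Fin.zero)) (*-identityˡ _))
                           (ΣF-zero n (λ k → *-absorbˡ _ (upper Fin.zero (Fin.suc k) (ℕ.s≤s ℕ.z≤n)))))
                   (+-identityʳ _)
    minors : ∀ j → det R n (minor W j) ≈ det R n (minor V j)
    minors j = det-unitriangular n (λ r k → L (Fin.suc r) (Fin.suc k)) (λ k c → V (Fin.suc k) (punchIn j c))
                 (λ i → diag (Fin.suc i)) (λ i k h → upper (Fin.suc i) (Fin.suc k) (ℕ.s≤s h))

  det-zeroColumn : ∀ n (X : Mat (suc n)) → (∀ r → X r Fin.zero ≈ 0#) → det R (suc n) X ≈ 0#
  det-offDiagonalMinor : ∀ n (X : Mat (suc n)) → (∀ r → X (Fin.suc r) Fin.zero ≈ 0#) →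
                         ∀ j → det R n (minor X (Fin.suc j)) ≈ 0#

  det-zeroColumn n X h = trans (+-cong (*-absorbʳ 1# (*-absorbˡ _ (h Fin.zero)))
    (ΣF-zero n (λ j → *-absorbʳ _ (*-absorbʳ _ (det-offDiagonalMinor n X (λ r → h (Fin.suc r)) j)))))
    (+-identityˡ 0#)

  det-offDiagonalMinor (suc m) X h j = det-zeroColumn m (minor X (Fin.suc j)) h

  det-upperTriangular : ∀ n (U : Mat n) (d : ℕ → Carrier) →
                        (∀ k j → toℕ j ℕ.< toℕ k → U k j ≈ 0#) → (∀ k → U k k ≈ d (toℕ k)) →
                        det R n U ≈ ∏ n d
  det-upperTriangular zero    U d lower diag = refl
  det-upperTriangular (suc n) U d lower diag = begin
    det R (suc n) U
      ≈⟨ +-congˡ (ΣF-zero n (λ j → *-absorbʳ _ (*-absorbʳ _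
           (det-offDiagonalMinor n U (λ r → lower (Fin.suc r) Fin.zero (ℕ.s≤s ℕ.z≤n)) j)))) ⟩
    sg {suc n} Fin.zero * (U Fin.zero Fin.zero * det R n (minor U Fin.zero)) + 0#
      ≈⟨ trans (+-identityʳ _) (*-identityˡ _) ⟩
    U Fin.zero Fin.zero * det R n (minor U Fin.zero)
      ≈⟨ *-cong (diag Fin.zero) (det-upperTriangular n (minor U Fin.zero) (λ k → d (suc k))
                 (λ k j h → lower (Fin.suc k) (Fin.suc j) (ℕ.s≤s h)) (λ k → diag (Fin.suc k))) ⟩
    d 0 * ∏ n (λ k → d (suc k))
      ≈⟨ ∏-head n d ⟨
    ∏ (suc n) d ∎

  SolvesRec : Carrier → Carrier → Series R → Series R → Set ℓ
  SolvesRec s β T X = ∀ n → X (suc n) ≈ s * X n + β * (T ⋆ X) n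

  solvesRec-unique : ∀ {s β T T′ X Y} → SolvesRec s β T X → SolvesRec s β T′ Y → X 0 ≈ Y 0 →
                     ∀ K → (∀ j → j ℕ.< K → T j ≈ T′ j) → ∀ n → n ℕ.≤ K → X n ≈ Y n
  solvesRec-unique {s} {β} {T} {T′} {X} {Y} recX recY start K agree =
    <-rec (λ n → n ℕ.≤ K → X n ≈ Y n) step
    where
    step : ∀ n → (∀ {m} → m ℕ.< n → m ℕ.≤ K → X m ≈ Y m) → n ℕ.≤ K → X n ≈ Y n
    step zero    ih _ = start
    step (suc n) ih h = begin
      X (suc n)                 ≈⟨ recX n ⟩
      s * X n + β * (T ⋆ X) n   ≈⟨ +-cong (*-congˡ (ih ℕₚ.≤-refl n≤K)) (*-congˡ (Σ-cong n term)) ⟩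
      s * Y n + β * (T′ ⋆ Y) n  ≈⟨ recY n ⟨
      Y (suc n)                 ∎
      where
      n≤K : n ℕ.≤ K
      n≤K = ℕₚ.≤-trans (ℕₚ.n≤1+n n) h
      term : ∀ j → j ℕ.< n → T j * X (n ∸ suc j) ≈ T′ j * Y (n ∸ suc j)
      term j j<n = *-cong (agree j (ℕₚ.<-≤-trans j<n n≤K))
                          (ih (ℕ.s≤s (ℕₚ.m∸n≤m n (suc j))) (ℕₚ.≤-trans (ℕₚ.m∸n≤m n (suc j)) n≤K))

  module Geometric (u : Series R) (u₀ : u 0 ≈ 0#) where
    G : Series R
    G = geom R u

    powS-vanish : ∀ j m → m ℕ.< j → powS R u j m ≈ 0#
    powS-vanish (suc j) m h = begin
      Σ (suc m) (λ k → u k * powS R u j (m ∸ k))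
        ≈⟨ Σ-head m _ ⟩
      u 0 * powS R u j m + Σ m (λ k → u (suc k) * powS R u j (m ∸ suc k))
        ≈⟨ +-cong (*-absorbˡ _ u₀)
                  (Σ-zero m (λ k k<m → *-absorbʳ _ (powS-vanish j (m ∸ suc k) (lower k k<m)))) ⟩
      0# + 0# ≈⟨ +-identityˡ _ ⟩
      0# ∎
      where
      lower : ∀ k → k ℕ.< m → m ∸ suc k ℕ.< j
      lower k k<m = ℕₚ.<-≤-trans (ℕₚ.≤-trans (ℕₚ.≤-reflexive (≡.sym (∸-peel k<m))) (ℕₚ.m∸n≤m m k))
                                 (ℕₚ.≤-pred h)

    G-fixpoint : ∀ m → G (suc m) ≈ _⊗_ R u G (suc m)
    G-fixpoint m = begin
      Σ (suc N) (λ j → powS R u j N)                           ≈⟨ Σ-head N _ ⟩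
      0# + Σ N (λ j → powS R u (suc j) N)                      ≈⟨ +-identityˡ _ ⟩
      Σ N (λ j → Σ (suc N) (λ k → u k * powS R u j (N ∸ k)))   ≈⟨ Σ-swap N (suc N) _ ⟩
      Σ (suc N) (λ k → Σ N (λ j → u k * powS R u j (N ∸ k)))   ≈⟨ Σ-cong (suc N) (λ k _ → sym (Σ-*ˡ N (u k) _)) ⟩
      Σ (suc N) (λ k → u k * Σ N (λ j → powS R u j (N ∸ k)))   ≈⟨ Σ-cong (suc N) (λ k _ → truncate k) ⟩
      Σ (suc N) (λ k → u k * G (N ∸ k))                        ∎
      where
      N = suc m
      -- the powers uʲ with j > N ∸ k do not contribute in degree N ∸ k
      truncate : ∀ k → u k * Σ N (λ j → powS R u j (N ∸ k)) ≈ u k * G (N ∸ k)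
      truncate zero    = trans (*-absorbˡ _ u₀) (sym (*-absorbˡ _ u₀))
      truncate (suc k) = *-congˡ (trans (Σ-length _ (≡.sym (ℕₚ.m+[n∸m]≡n (ℕ.s≤s (ℕₚ.m∸n≤m m k)))))
                                        (Σ-pad (suc (m ∸ k)) _ _ (λ j h → powS-vanish j (m ∸ k) h)))

  jLevel-solvesRec : ∀ s β (T : Series R) →
    SolvesRec s β T (geom R (_⊕_ R (xS R (constS R s)) (xS R (xS R (_⊗_ R (constS R β) T)))))
  jLevel-solvesRec s β T n = begin
    G (suc n)                                                            ≈⟨ G-fixpoint n ⟩
    Σ (suc (suc n)) (λ k → u k * G (suc n ∸ k))                          ≈⟨ Σ-head (suc n) _ ⟩
    u 0 * G (suc n) + Σ (suc n) (λ k → u (suc k) * G (n ∸ k))            ≈⟨ +-cong (*-absorbˡ _ u₀) (Σ-head n _) ⟩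
    0# + (u 1 * G n + Σ n (λ k → u (suc (suc k)) * G (n ∸ suc k)))       ≈⟨ +-identityˡ _ ⟩
    u 1 * G n + Σ n (λ k → u (suc (suc k)) * G (n ∸ suc k))
      ≈⟨ +-cong (*-congʳ (+-identityʳ s)) (Σ-cong n (λ k _ → trans (*-congʳ (u-coefficient k)) (*-assoc _ _ _))) ⟩
    s * G n + Σ n (λ k → β * (T k * G (n ∸ suc k)))                     ≈⟨ +-congˡ (sym (Σ-*ˡ n β _)) ⟩
    s * G n + β * (T ⋆ G) n                                              ∎
    where
    u : Series R
    u = _⊕_ R (xS R (constS R s)) (xS R (xS R (_⊗_ R (constS R β) T)))
    u₀ : u 0 ≈ 0#
    u₀ = +-identityˡ 0#
    open Geometric u u₀
    u-coefficient : ∀ k → u (suc (suc k)) ≈ β * T k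
    u-coefficient k = begin
      0# + Σ (suc k) (λ i → constS R β i * T (k ∸ i)) ≈⟨ +-identityˡ _ ⟩
      Σ (suc k) (λ i → constS R β i * T (k ∸ i))      ≈⟨ Σ-head k _ ⟩
      β * T k + Σ k (λ i → 0# * T (k ∸ suc i))        ≈⟨ +-congˡ (Σ-zero k (λ i _ → zeroˡ _)) ⟩
      β * T k + 0#                                    ≈⟨ +-identityʳ _ ⟩
      β * T k                                         ∎

  jFraction-coefficients : ∀ s β b → b 0 ≈ 1# → SolvesRec s β b b →
                           ∀ n → J R (λ _ → s) (λ _ → β) n ≈ b n
  jFraction-coefficients s β b b₀ b-rec n = truncation-agrees (suc n) n (ℕₚ.n≤1+n n)
    where
    truncation-agrees : ∀ k n → n ℕ.≤ k → Jtrunc R k (λ _ → s) (λ _ → β) n ≈ b n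
    truncation-agrees zero    .zero ℕ.z≤n = sym b₀
    truncation-agrees (suc k) n h =
      solvesRec-unique (jLevel-solvesRec s β (Jtrunc R k (λ _ → s) (λ _ → β))) b-rec
        constantTerm (suc k)
        (λ j j<k → truncation-agrees k j (ℕₚ.≤-pred j<k)) n h
      where
      constantTerm : Jtrunc R (suc k) (λ _ → s) (λ _ → β) 0 ≈ b 0
      constantTerm = trans (+-identityˡ 1#) (sym b₀)

  module Tridiagonal (s β : Carrier) where
    shiftDown : Series R → Series R
    shiftDown = xS R

    tridiagonal : Series R → Series R
    tridiagonal u k = shiftDown u k + (s * u k + β * u (suc k))

    ⟨_,_⟩ : Series R → Series R → ℕ → Carrier
    ⟨ u , v ⟩ N = Σ N (λ k → u k * (pow R β k * v k))

    ⟨⟩-cong : ∀ N {u u′ v v′} → (∀ k → u k ≈ u′ k) → (∀ k → v k ≈ v′ k) →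
              ⟨ u , v ⟩ N ≈ ⟨ u′ , v′ ⟩ N
    ⟨⟩-cong N hu hv = Σ-cong N (λ k _ → *-cong (hu k) (*-congˡ (hv k)))

    ⟨⟩-linearˡ : ∀ N x y z v →
      ⟨ (λ k → x k + (s * y k + β * z k)) , v ⟩ N ≈ ⟨ x , v ⟩ N + (s * ⟨ y , v ⟩ N + β * ⟨ z , v ⟩ N)
    ⟨⟩-linearˡ N x y z v = trans (Σ-cong N (λ k _ → expand k))
      (trans (Σ-+ N _ _) (+-congˡ (trans (Σ-+ N _ _) (+-cong (sym (Σ-*ˡ N s _)) (sym (Σ-*ˡ N β _))))))
      where
      expand : ∀ k → (x k + (s * y k + β * z k)) * (pow R β k * v k)
                     ≈ x k * (pow R β k * v k) + (s * (y k * (pow R β k * v k)) + β * (z k * (pow R β k * v k)))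
      expand k = solve 6 (λ a s' b β' d w →
                   (a :+ (s' :* b :+ β' :* d)) :* w := a :* w :+ (s' :* (b :* w) :+ β' :* (d :* w)))
                   refl (x k) s (y k) β (z k) (pow R β k * v k)

    ⟨⟩-linearʳ : ∀ N u x y z →
      ⟨ u , (λ k → x k + (s * y k + z k)) ⟩ N ≈ ⟨ u , x ⟩ N + (s * ⟨ u , y ⟩ N + ⟨ u , z ⟩ N)
    ⟨⟩-linearʳ N u x y z = trans (Σ-cong N (λ k _ → expand k))
      (trans (Σ-+ N _ _) (+-congˡ (trans (Σ-+ N _ _) (+-congʳ (sym (Σ-*ˡ N s _))))))
      where
      expand : ∀ k → u k * (pow R β k * (x k + (s * y k + z k)))
                     ≈ u k * (pow R β k * x k) + (s * (u k * (pow R β k * y k)) + u k * (pow R β k * z k))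
      expand k = solve 6 (λ a w b s' d e →
                   a :* (w :* (b :+ (s' :* d :+ e))) := a :* (w :* b) :+ (s' :* (a :* (w :* d)) :+ a :* (w :* e)))
                   refl (u k) (pow R β k) (x k) s (y k) (z k)

    -- moving a shift across the pairing: the weight βᵏ⁺¹ = β βᵏ supplies the factor β
    ⟨shiftDown,⟩ : ∀ N u v → u N ≈ 0# →
                   ⟨ shiftDown u , v ⟩ (suc N) ≈ ⟨ u , (λ k → β * v (suc k)) ⟩ (suc N)
    ⟨shiftDown,⟩ N u v uN = begin
      ⟨ shiftDown u , v ⟩ (suc N)                                      ≈⟨ Σ-head N _ ⟩
      0# * (pow R β 0 * v 0) + Σ N (λ k → u k * (pow R β (suc k) * v (suc k)))
        ≈⟨ trans (+-congʳ (zeroˡ _)) (+-identityˡ _) ⟩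
      Σ N (λ k → u k * (pow R β (suc k) * v (suc k)))
        ≈⟨ Σ-cong N (λ k _ → *-congˡ (solve 3 (λ β' w d → (β' :* w) :* d := w :* (β' :* d))
                                          refl β (pow R β k) (v (suc k)))) ⟩
      ⟨ u , (λ k → β * v (suc k)) ⟩ N                                  ≈⟨ +-identityʳ _ ⟨
      ⟨ u , (λ k → β * v (suc k)) ⟩ N + 0#                             ≈⟨ +-congˡ (*-absorbˡ _ uN) ⟨
      ⟨ u , (λ k → β * v (suc k)) ⟩ (suc N)                            ∎

    ⟨,shiftDown⟩ : ∀ N u v → u N ≈ 0# → β * ⟨ (λ k → u (suc k)) , v ⟩ N ≈ ⟨ u , shiftDown v ⟩ N
    ⟨,shiftDown⟩ zero    u v uN = zeroʳ β
    ⟨,shiftDown⟩ (suc N) u v uN = begin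
      β * ⟨ (λ k → u (suc k)) , v ⟩ (suc N)                           ≈⟨ Σ-*ˡ (suc N) β _ ⟩
      Σ N (λ k → β * (u (suc k) * (pow R β k * v k))) + β * (u (suc N) * (pow R β N * v N))
        ≈⟨ trans (+-congˡ (*-absorbʳ β (*-absorbˡ _ uN))) (+-identityʳ _) ⟩
      Σ N (λ k → β * (u (suc k) * (pow R β k * v k)))
        ≈⟨ Σ-cong N (λ k _ → solve 4 (λ β' a w d → β' :* (a :* (w :* d)) := a :* ((β' :* w) :* d))
                               refl β (u (suc k)) (pow R β k) (v k)) ⟩
      Σ N (λ k → u (suc k) * (pow R β (suc k) * v k))                 ≈⟨ +-identityˡ _ ⟨
      0# + Σ N (λ k → u (suc k) * (pow R β (suc k) * v k))            ≈⟨ +-congʳ (*-absorbʳ _ (*-absorbʳ _ refl)) ⟨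
      u 0 * (pow R β 0 * 0#) + Σ N (λ k → u (suc k) * (pow R β (suc k) * v k))
        ≈⟨ Σ-head N _ ⟨
      ⟨ u , shiftDown v ⟩ (suc N)                                      ∎

    tridiagonal-selfAdjoint : ∀ N u v → u N ≈ 0# → u (suc N) ≈ 0# →
      ⟨ tridiagonal u , v ⟩ (suc N) ≈ ⟨ u , tridiagonal v ⟩ (suc N)
    tridiagonal-selfAdjoint N u v uN uN+1 = begin
      ⟨ tridiagonal u , v ⟩ (suc N)
        ≈⟨ ⟨⟩-linearˡ (suc N) (shiftDown u) u (λ k → u (suc k)) v ⟩
      ⟨ shiftDown u , v ⟩ (suc N) + (s * ⟨ u , v ⟩ (suc N) + β * ⟨ (λ k → u (suc k)) , v ⟩ (suc N))
        ≈⟨ +-cong (⟨shiftDown,⟩ N u v uN) (+-congˡ (⟨,shiftDown⟩ (suc N) u v uN+1)) ⟩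
      ⟨ u , (λ k → β * v (suc k)) ⟩ (suc N) + (s * ⟨ u , v ⟩ (suc N) + ⟨ u , shiftDown v ⟩ (suc N))
        ≈⟨ solve 3 (λ a b d → a :+ (b :+ d) := d :+ (b :+ a)) refl _ _ _ ⟩
      ⟨ u , shiftDown v ⟩ (suc N) + (s * ⟨ u , v ⟩ (suc N) + ⟨ u , (λ k → β * v (suc k)) ⟩ (suc N))
        ≈⟨ ⟨⟩-linearʳ (suc N) u (shiftDown v) v (λ k → β * v (suc k)) ⟨
      ⟨ u , tridiagonal v ⟩ (suc N) ∎

  -- The Stieltjes table of a solution b of its own recurrence: μ n k = [xⁿ] xᵏ B(x)ᵏ⁺¹.
  module StieltjesTable (s β : Carrier) (b : Series R) (b₀ : b 0 ≈ 1#) (b-rec : SolvesRec s β b b) where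
    open Tridiagonal s β

    μ : ℕ → ℕ → Carrier
    μ n zero    = b n
    μ n (suc k) = ((λ m → μ m k) ⋆ b) n

    μ-aboveDiagonal : ∀ n k → n ℕ.< k → μ n k ≈ 0#
    μ-aboveDiagonal n (suc k) h =
      Σ-zero n (λ j j<n → *-absorbˡ _ (μ-aboveDiagonal j k (ℕₚ.<-≤-trans j<n (ℕₚ.≤-pred h))))

    μ-diagonal : ∀ n → μ n n ≈ 1#
    μ-diagonal zero    = b₀
    μ-diagonal (suc n) = begin
      Σ n (λ j → μ j n * b (n ∸ j)) + μ n n * b (n ∸ n)
        ≈⟨ +-cong (Σ-zero n (λ j j<n → *-absorbˡ _ (μ-aboveDiagonal j n j<n)))
                  (*-cong (μ-diagonal n) (reflexive (≡.cong b (ℕₚ.n∸n≡0 n)))) ⟩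
      0# + 1# * b 0 ≈⟨ trans (+-identityˡ _) (trans (*-identityˡ _) b₀) ⟩
      1# ∎

    μ-step : ∀ n k → μ (suc n) k ≈ tridiagonal (μ n) k
    μ-step n zero    = trans (b-rec n) (sym (+-identityˡ _))
    μ-step n (suc k) = begin
      Σ n (λ j → μ j k * b (n ∸ j)) + μ n k * b (n ∸ n)
        ≈⟨ +-cong (Σ-cong n peel) (*-congˡ (trans (reflexive (≡.cong b (ℕₚ.n∸n≡0 n))) b₀)) ⟩
      Σ n (λ j → s * (μ j k * b (n ∸ suc j)) + β * (μ j k * (b ⋆ b) (n ∸ suc j))) + μ n k * 1#
        ≈⟨ +-cong (Σ-+ n _ _) (*-identityʳ _) ⟩
      (Σ n (λ j → s * (μ j k * b (n ∸ suc j))) + Σ n (λ j → β * (μ j k * (b ⋆ b) (n ∸ suc j)))) + μ n k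
        ≈⟨ +-congʳ (+-cong (sym (Σ-*ˡ n s _)) (sym (Σ-*ˡ n β _))) ⟩
      (s * μ n (suc k) + β * ((λ m → μ m k) ⋆ (b ⋆ b)) n) + μ n k
        ≈⟨ +-comm _ _ ⟩
      μ n k + (s * μ n (suc k) + β * ((λ m → μ m k) ⋆ (b ⋆ b)) n)
        ≈⟨ +-congˡ (+-congˡ (*-congˡ (sym (⋆-assoc (λ m → μ m k) b b n)))) ⟩
      μ n k + (s * μ n (suc k) + β * μ n (suc (suc k))) ∎
      where
      peel : ∀ j → j ℕ.< n → μ j k * b (n ∸ j) ≈ s * (μ j k * b (n ∸ suc j)) + β * (μ j k * (b ⋆ b) (n ∸ suc j))
      peel j h = begin
        μ j k * b (n ∸ j)                                          ≈⟨ *-congˡ (reflexive (≡.cong b (∸-peel h))) ⟩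
        μ j k * b (suc (n ∸ suc j))                                ≈⟨ *-congˡ (b-rec _) ⟩
        μ j k * (s * b (n ∸ suc j) + β * (b ⋆ b) (n ∸ suc j))
          ≈⟨ solve 5 (λ m s' d β' e → m :* (s' :* d :+ β' :* e) := s' :* (m :* d) :+ β' :* (m :* e)) refl
               (μ j k) s (b (n ∸ suc j)) β ((b ⋆ b) (n ∸ suc j)) ⟩
        s * (μ j k * b (n ∸ suc j)) + β * (μ j k * (b ⋆ b) (n ∸ suc j)) ∎

    hankel-entry : ∀ N i j → i ℕ.< N → ⟨ μ i , μ j ⟩ N ≈ b (i ℕ.+ j)
    hankel-entry (suc N) zero    j _ = begin
      ⟨ μ 0 , μ j ⟩ (suc N)                                         ≈⟨ Σ-head N _ ⟩
      b 0 * (1# * b j) + Σ N (λ k → 0# * (pow R β (suc k) * μ j (suc k)))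
        ≈⟨ +-cong (trans (*-cong b₀ (*-identityˡ _)) (*-identityˡ _)) (Σ-zero N (λ k _ → zeroˡ _)) ⟩
      b j + 0#                                                       ≈⟨ +-identityʳ _ ⟩
      b j                                                            ∎
    hankel-entry (suc N) (suc i) j h = begin
      ⟨ μ (suc i) , μ j ⟩ (suc N)               ≈⟨ ⟨⟩-cong (suc N) (μ-step i) (λ _ → refl) ⟩
      ⟨ tridiagonal (μ i) , μ j ⟩ (suc N)       ≈⟨ tridiagonal-selfAdjoint N (μ i) (μ j)
                                                     (μ-aboveDiagonal i N (ℕₚ.≤-pred h))
                                                     (μ-aboveDiagonal i (suc N) (ℕₚ.m<n⇒m<1+n (ℕₚ.≤-pred h))) ⟩
      ⟨ μ i , tridiagonal (μ j) ⟩ (suc N)       ≈⟨ ⟨⟩-cong (suc N) (λ _ → refl) (λ k → sym (μ-step j k)) ⟩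
      ⟨ μ i , μ (suc j) ⟩ (suc N)               ≈⟨ hankel-entry (suc N) i (suc j) (ℕₚ.m<n⇒m<1+n (ℕₚ.≤-pred h)) ⟩
      b (i ℕ.+ suc j)                           ≡⟨ ≡.cong b (ℕₚ.+-suc i j) ⟩
      b (suc i ℕ.+ j)                           ∎

  hankelDeterminant : ∀ s β b → b 0 ≈ 1# → SolvesRec s β b b →
                      ∀ n → det R n (λ i j → b (toℕ i ℕ.+ toℕ j)) ≈ pow R β (n C 2)
  hankelDeterminant s β b b₀ b-rec n = begin
    det R n (λ i j → b (toℕ i ℕ.+ toℕ j))
      ≈⟨ det-cong n factorise ⟩
    det R n (λ i j → ΣF n (λ k → L i k * U k j))
      ≈⟨ det-unitriangular n L U (λ i → μ-diagonal (toℕ i)) (λ i k → μ-aboveDiagonal (toℕ i) (toℕ k)) ⟩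
    det R n U
      ≈⟨ det-upperTriangular n U (pow R β) (λ k j h → *-absorbʳ _ (μ-aboveDiagonal (toℕ j) (toℕ k) h))
           (λ k → trans (*-congˡ (μ-diagonal (toℕ k))) (*-identityʳ _)) ⟩
    ∏ n (pow R β)
      ≈⟨ ∏-powers β n ⟩
    pow R β (n C 2) ∎
    where
    open StieltjesTable s β b b₀ b-rec
    L U : Mat n
    L i k = μ (toℕ i) (toℕ k)
    U k j = pow R β (toℕ k) * μ (toℕ j) (toℕ k)
    factorise : ∀ i j → b (toℕ i ℕ.+ toℕ j) ≈ ΣF n (λ k → L i k * U k j)
    factorise i j = sym (trans (ΣF-toℕ n (λ k → μ (toℕ i) k * (pow R β k * μ (toℕ j) k)))
                               (hankel-entry n (toℕ i) (toℕ j) (toℕ<n i)))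

  rescaled-recurrence : ∀ p s t p⁻¹ → p * p⁻¹ ≈ 1# → (a : ℕ → Carrier) → a 1 ≈ p →
    (∀ n → a (suc (suc n)) ≈ s * a (suc n) + t * sumTo R n (λ k → a (suc k) * a (n ∸ k))) →
    let b = λ m → p⁻¹ * a (suc m) in b 0 ≈ 1# × SolvesRec s (p * t) b b
  rescaled-recurrence p s t p⁻¹ pp⁻¹ a a₁ a-rec = b₀ , b-rec
    where
    b : Series R
    b m = p⁻¹ * a (suc m)
    p*b : ∀ m → p * b m ≈ a (suc m)
    p*b m = trans (sym (*-assoc _ _ _)) (trans (*-congʳ pp⁻¹) (*-identityˡ _))
    b₀ : b 0 ≈ 1#
    b₀ = trans (*-congˡ a₁) (trans (*-comm p⁻¹ p) pp⁻¹)
    product : ∀ n k → k ℕ.< n → a (suc k) * a (n ∸ k) ≈ p * (p * (b k * b (n ∸ suc k)))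
    product n k h = begin
      a (suc k) * a (n ∸ k)             ≈⟨ *-congˡ (reflexive (≡.cong a (∸-peel h))) ⟩
      a (suc k) * a (suc (n ∸ suc k))   ≈⟨ *-cong (sym (p*b k)) (sym (p*b (n ∸ suc k))) ⟩
      (p * b k) * (p * b (n ∸ suc k))   ≈⟨ solve 3 (λ p' x y → (p' :* x) :* (p' :* y) := p' :* (p' :* (x :* y)))
                                              refl p (b k) (b (n ∸ suc k)) ⟩
      p * (p * (b k * b (n ∸ suc k)))   ∎
    b-rec : SolvesRec s (p * t) b b
    b-rec n = begin
      p⁻¹ * a (suc (suc n))
        ≈⟨ *-congˡ (a-rec n) ⟩
      p⁻¹ * (s * a (suc n) + t * Σ n (λ k → a (suc k) * a (n ∸ k)))
        ≈⟨ *-congˡ (+-cong (*-congˡ (sym (p*b n))) (*-congˡ (Σ-cong n (product n)))) ⟩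
      p⁻¹ * (s * (p * b n) + t * Σ n (λ k → p * (p * (b k * b (n ∸ suc k)))))
        ≈⟨ *-congˡ (+-congˡ (*-congˡ (trans (sym (Σ-*ˡ n p _)) (*-congˡ (sym (Σ-*ˡ n p _)))))) ⟩
      p⁻¹ * (s * (p * b n) + t * (p * (p * (b ⋆ b) n)))
        ≈⟨ solve 6 (λ q s' p' x t' y →
                      q :* (s' :* (p' :* x) :+ t' :* (p' :* (p' :* y))) := (p' :* q) :* (s' :* x :+ (p' :* t') :* y))
             refl p⁻¹ s p (b n) t ((b ⋆ b) n) ⟩
      (p * p⁻¹) * (s * b n + (p * t) * (b ⋆ b) n)
        ≈⟨ trans (*-congʳ pp⁻¹) (*-identityˡ _) ⟩
      s * b n + (p * t) * (b ⋆ b) n ∎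

-- The theorem: with bₙ = p⁻¹ aₙ₊₁ and β = p t, both claims are the general results
-- above; only p p⁻¹ = 1 and a₁ = p are needed besides the recurrence.
mainTheorem5 : ∀ {c ℓ : Level} (R : CommutativeRing c ℓ) → IsField R →
    let open CommutativeRing R in
    (p s t p⁻¹ : Carrier) → ¬ (p ≈ 0#) → p * p⁻¹ ≈ 1# →
    (a : ℕ → Carrier) → a 0 ≈ 1# → a 1 ≈ p →
    (∀ n → a (suc (suc n)) ≈ s * a (suc n) + t * sumTo R n (λ k → a (suc k) * a (n ∸ k))) →
    (∀ n → p⁻¹ * a (suc n) ≈ J R (λ _ → s) (λ _ → p * t) n)
    × (∀ n → det R (suc n) (λ i j → p⁻¹ * a (suc (toℕ i ℕ.+ toℕ j))) ≈ pow R (p * t) ((suc n) C 2))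
mainTheorem5 R _ p s t p⁻¹ _ pp⁻¹ a _ a₁ a-rec
  with rescaled-recurrence R p s t p⁻¹ pp⁻¹ a a₁ a-rec
... | b₀ , b-rec = (λ n → sym (jFraction-coefficients R s (p * t) _ b₀ b-rec n))
                 , hankelDeterminant R s (p * t) _ b₀ b-rec ∘ suc
  where open CommutativeRing R using (sym; _*_)
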